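{- Let $\mathcal{T}$ be the space of torsion-free abelian group operations on $\mathbb{N}$ with identity $0$ (as defined in the context), and let $\mathcal{P}\subseteq\mathcal{S}\subseteq\mathcal{T}$ be group properties. Suppose that for every nonempty set of the form $\mathcal{B}=\{G\in\mathcal{S}:\ \forall i,j\le k\ (G(i,j)=m_{i,j})\}$ (with $k\in\mathbb{N}$ and $m_{i,j}\in\mathbb{N}$) there exist $G_0\in\mathcal{B}$, $H\in\mathcal{P}$ and a group homomorphism $\varphi:(\mathbb{N},G_0)\to(\mathbb{N},H)$ such that $\varphi$ restricted to $\operatorname{supp}\mathcal{B}=\{1,\ldots,k\}\cup\{m_{i,j}: i,j\le k\}$ is injective. Then $\mathcal{P}$ is dense in $\mathcal{S}$.
   Context: $\mathbb{N}=\{0,1,2,\ldots\}$. $\mathcal{T}$ is the set of functions $G:\mathbb{N}\times\mathbb{N}\to\mathbb{N}$ that are the operation of a torsion-free abelian group on $\mathbb{N}$ with identity element $0$, with the subspace topology from the product $\mathbb{N}^{\mathbb{N}\times\mathbb{N}}$ (each factor discrete). A set $\mathcal{P}\subseteq\mathcal{T}$ is a group property if it is invariant under isomorphism: whenever $G\in\mathcal{T}$ and $(\mathbb{N},G)$ is isomorphic to $(\mathbb{N},H)$ for some $H\in\mathcal{P}$, then $G\in\mathcal{P}$. Density of $\mathcal{P}$ in $\mathcal{S}$ is with respect to the subspace topology on $\mathcal{S}$. -}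

module Defs where

open import Data.Nat using (ℕ; zero; suc; _≤_)
open import Data.Product using (Σ; ∃; ∃-syntax; _×_; _,_)
open import Data.Sum using (_⊎_)
open import Relation.Binary.PropositionalEquality using (_≡_)
open import Function.Definitions using (Bijective)

Op : Set
Op = ℕ → ℕ → ℕ

OpSet : Set₁
OpSet = Op → Set

nsmul : Op → ℕ → ℕ → ℕ
nsmul G zero    a = 0
nsmul G (suc n) a = G a (nsmul G n a)

record IsTFAbOp (G : Op) : Set where
  field
    assoc       : ∀ a b c → G (G a b) c ≡ G a (G b c)
    comm        : ∀ a b → G a b ≡ G b a
    identityˡ   : ∀ a → G 0 a ≡ a
    inverse     : ∀ a → ∃[ b ] (G a b ≡ 0)
    torsionFree : ∀ n a → nsmul G (suc n) a ≡ 0 → a ≡ 0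

𝒯 : OpSet
𝒯 = IsTFAbOp

_⊆_ : OpSet → OpSet → Set
P ⊆ S = ∀ G → P G → S G

IsHom : Op → Op → (ℕ → ℕ) → Set
IsHom G H φ = ∀ a b → φ (G a b) ≡ H (φ a) (φ b)

Isomorphic : Op → Op → Set
Isomorphic G H = Σ (ℕ → ℕ) λ φ → IsHom G H φ × Bijective _≡_ _≡_ φ

IsGroupProperty : OpSet → Set
IsGroupProperty P =
  (P ⊆ 𝒯) × (∀ G H → 𝒯 G → P H → Isomorphic G H → P G)

AgreeUpTo : ℕ → Op → Op → Set
AgreeUpTo k G H = ∀ i j → i ≤ k → j ≤ k → G i j ≡ H i j

-- Product topology on ℕ^(ℕ×ℕ) (discrete factors): U is open iff every
-- point of U has a basic neighbourhood (fixing all coordinates (i,j)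
-- with i,j ≤ k, for some k) contained in U.
IsOpen : OpSet → Set
IsOpen U = ∀ f → U f → ∃[ k ] (∀ g → AgreeUpTo k f g → U g)

-- P is dense in S (subspace topology): every open set meeting S meets P.
Dense : OpSet → OpSet → Set₁
Dense P S = ∀ (U : OpSet) → IsOpen U →
  (∃[ G ] (S G × U G)) → ∃[ H ] (P H × U H)

InBasic : OpSet → ℕ → Op → Op → Set
InBasic S k m G = S G × AgreeUpTo k G m

InSupp : ℕ → Op → ℕ → Set
InSupp k m x = (1 ≤ x × x ≤ k) ⊎ (∃[ i ] ∃[ j ] (i ≤ k × j ≤ k × m i j ≡ x))

InjectiveOn : (ℕ → Set) → (ℕ → ℕ) → Set
InjectiveOn A φ = ∀ x y → A x → A y → φ x ≡ φ y → x ≡ y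

-- Let G ∈ S lie in an open set U, and let k be such that every
-- operation agreeing with G on {0,…,k}² lies in U. The hypothesis applied to
-- the basic set fixing G there gives a homomorphism φ : G₀ → H, H ∈ P, that is
-- injective on the finite support of the basic set. A permutation π of ℕ
-- undoing φ on that support, transported onto H, yields an isomorphic copy
-- H′ of H which agrees with G on {0,…,k}²; H′ ∈ P by invariance and H′ ∈ U.
module Submission where

open import Defs
open import Data.Nat as ℕ using (ℕ; suc; _≤_; s≤s; z≤n)
open import Data.Product using (Σ-syntax; ∃-syntax; _×_; _,_)
open import Data.Sum using (inj₁; inj₂)
open import Data.List using (List; []; _∷_; _++_; upTo; cartesianProductWith)
open import Data.List.Relation.Unary.Any using (here; there)
open import Data.List.Membership.Propositional using (_∈_)
open import Data.List.Membership.Propositional.Properties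
  using (∈-++⁺ˡ; ∈-++⁺ʳ; ∈-++⁻; ∈-upTo⁺; ∈-upTo⁻; ∈-cartesianProductWith⁺; ∈-cartesianProductWith⁻)
open import Function using (_∘_)
open import Function.Bundles using (_↔_; Inverse; Bijection; mk↔ₛ′)
open import Function.Definitions using (Bijective)
open import Function.Properties.Inverse using (↔-sym; Inverse⇒Bijection)
open import Relation.Binary.Definitions using (DecidableEquality)
open import Relation.Binary.PropositionalEquality
open import Relation.Nullary using (yes; no; contradiction)

module Permutations {a} {A : Set a} (_≟_ : DecidableEquality A) where

  transpose : A → A → A → A
  transpose u v x with x ≟ u
  ... | yes _ = v
  ... | no _ with x ≟ v
  ...   | yes _ = u
  ...   | no _  = x

  transpose-≡ˡ : ∀ u v → transpose u v u ≡ v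
  transpose-≡ˡ u v with u ≟ u
  ... | yes _   = refl
  ... | no u≢u  = contradiction refl u≢u

  transpose-≡ʳ : ∀ u v → transpose u v v ≡ u
  transpose-≡ʳ u v with v ≟ u
  ... | yes v≡u = v≡u
  ... | no _ with v ≟ v
  ...   | yes _   = refl
  ...   | no v≢v  = contradiction refl v≢v

  transpose-≢ : ∀ {u v x} → x ≢ u → x ≢ v → transpose u v x ≡ x
  transpose-≢ {u} {v} {x} x≢u x≢v with x ≟ u
  ... | yes x≡u = contradiction x≡u x≢u
  ... | no _ with x ≟ v
  ...   | yes x≡v = contradiction x≡v x≢v
  ...   | no _ = refl

  transpose-involutive : ∀ u v x → transpose u v (transpose u v x) ≡ x
  transpose-involutive u v x with x ≟ u
  ... | yes refl = transpose-≡ʳ x v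
  ... | no x≢u with x ≟ v
  ...   | yes refl = transpose-≡ˡ u x
  ...   | no x≢v = transpose-≢ x≢u x≢v

  module _ (φ : A → A) where

    permutation : List A → A → A
    permutation []       y = y
    permutation (x ∷ xs) y = transpose (permutation xs (φ x)) x (permutation xs y)

    permutation⁻¹ : List A → A → A
    permutation⁻¹ []       y = y
    permutation⁻¹ (x ∷ xs) y = permutation⁻¹ xs (transpose (permutation xs (φ x)) x y)

    permutation⁻¹-inverseʳ : ∀ xs y → permutation⁻¹ xs (permutation xs y) ≡ y
    permutation⁻¹-inverseʳ []       y = refl
    permutation⁻¹-inverseʳ (x ∷ xs) y
      rewrite transpose-involutive (permutation xs (φ x)) x (permutation xs y)
      = permutation⁻¹-inverseʳ xs y

    permutation⁻¹-inverseˡ : ∀ xs y → permutation xs (permutation⁻¹ xs y) ≡ y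
    permutation⁻¹-inverseˡ []       y = refl
    permutation⁻¹-inverseˡ (x ∷ xs) y
      rewrite permutation⁻¹-inverseˡ xs (transpose (permutation xs (φ x)) x y)
      = transpose-involutive (permutation xs (φ x)) x y

    permutation-injective : ∀ xs {y z} → permutation xs y ≡ permutation xs z → y ≡ z
    permutation-injective xs {y} {z} eq = begin
      y                                     ≡⟨ permutation⁻¹-inverseʳ xs y ⟨
      permutation⁻¹ xs (permutation xs y)  ≡⟨ cong (permutation⁻¹ xs) eq ⟩
      permutation⁻¹ xs (permutation xs z)  ≡⟨ permutation⁻¹-inverseʳ xs z ⟩
      z                                     ∎
      where open ≡-Reasoning

    permutation-undoes : ∀ xs → (∀ {y z} → y ∈ xs → z ∈ xs → φ y ≡ φ z → y ≡ z) →
                         ∀ {y} → y ∈ xs → permutation xs (φ y) ≡ y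
    permutation-undoes (x ∷ xs) inj (here refl) = transpose-≡ˡ _ x
    permutation-undoes (x ∷ xs) inj {y} (there y∈xs)
      with y ≟ x | permutation-undoes xs (λ p q → inj (there p) (there q)) y∈xs
    ... | yes refl | ih rewrite ih = transpose-≡ˡ y y
    ... | no y≢x  | ih rewrite ih = transpose-≢ y≢π[φx] y≢x
      where
      y≢π[φx] : y ≢ permutation xs (φ x)
      y≢π[φx] y≡π[φx] =
        y≢x (inj (there y∈xs) (here refl) (permutation-injective xs (trans ih y≡π[φx])))

  left-inverse-extends-to-permutation :
    (φ : A → A) (xs : List A) → (∀ {y z} → y ∈ xs → z ∈ xs → φ y ≡ φ z → y ≡ z) →
    Σ[ π ∈ A ↔ A ] (∀ {x} → x ∈ xs → Inverse.to π (φ x) ≡ x)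
  left-inverse-extends-to-permutation φ xs inj =
    mk↔ₛ′ (permutation φ xs) (permutation⁻¹ φ xs)
          (permutation⁻¹-inverseˡ φ xs) (permutation⁻¹-inverseʳ φ xs) ,
    permutation-undoes φ xs inj

module _ {G H : Op} {φ : ℕ → ℕ} (hom : IsHom G H φ) (φ0≡0 : φ 0 ≡ 0) where

  IsHom-nsmul : ∀ n a → φ (nsmul G n a) ≡ nsmul H n (φ a)
  IsHom-nsmul ℕ.zero  a = φ0≡0
  IsHom-nsmul (suc n) a = trans (hom a _) (cong (H (φ a)) (IsHom-nsmul n a))

  𝒯-pullback : Bijective _≡_ _≡_ φ → 𝒯 H → 𝒯 G
  𝒯-pullback (injective , surjective) 𝒯H = record
    { assoc       = λ a b c → injective (begin
        φ (G (G a b) c)          ≡⟨ hom _ c ⟩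
        H (φ (G a b)) (φ c)      ≡⟨ cong (λ u → H u (φ c)) (hom a b) ⟩
        H (H (φ a) (φ b)) (φ c)  ≡⟨ assoc _ _ _ ⟩
        H (φ a) (H (φ b) (φ c))  ≡⟨ cong (H (φ a)) (hom b c) ⟨
        H (φ a) (φ (G b c))      ≡⟨ hom a _ ⟨
        φ (G a (G b c))          ∎)
    ; comm        = λ a b → injective (trans (hom a b) (trans (comm _ _) (sym (hom b a))))
    ; identityˡ   = λ a → injective
        (trans (hom 0 a) (trans (cong (λ u → H u (φ a)) φ0≡0) (identityˡ (φ a))))
    ; inverse     = λ a →
        let b , φa+b≡0 = inverse (φ a)
            b′ , φb′≡b = surjective b
        in b′ , injective (trans (hom a b′)
                  (trans (cong (H (φ a)) (φb′≡b refl)) (trans φa+b≡0 (sym φ0≡0))))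
    ; torsionFree = λ n a [n+1]a≡0 → injective (trans
        (torsionFree n (φ a) (trans (sym (IsHom-nsmul (suc n) a)) (trans (cong φ [n+1]a≡0) φ0≡0)))
        (sym φ0≡0))
    }
    where open IsTFAbOp 𝒯H
          open ≡-Reasoning

idempotent⇒≡0 : ∀ {H} → 𝒯 H → ∀ {a} → H a a ≡ a → a ≡ 0
idempotent⇒≡0 {H} 𝒯H {a} a+a≡a with b , a+b≡0 ← IsTFAbOp.inverse 𝒯H a = begin
  a               ≡⟨ identityˡ a ⟨
  H 0 a           ≡⟨ comm 0 a ⟩
  H a 0           ≡⟨ cong (H a) a+b≡0 ⟨
  H a (H a b)     ≡⟨ assoc a a b ⟨
  H (H a a) b     ≡⟨ cong (λ u → H u b) a+a≡a ⟩
  H a b           ≡⟨ a+b≡0 ⟩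
  0               ∎
  where open IsTFAbOp 𝒯H
        open ≡-Reasoning

IsHom-0 : ∀ {G H φ} → 𝒯 G → 𝒯 H → IsHom G H φ → φ 0 ≡ 0
IsHom-0 {G} {H} {φ} 𝒯G 𝒯H hom = idempotent⇒≡0 𝒯H (begin
  H (φ 0) (φ 0)  ≡⟨ hom 0 0 ⟨
  φ (G 0 0)      ≡⟨ cong φ (IsTFAbOp.identityˡ 𝒯G 0) ⟩
  φ 0            ∎)
  where open ≡-Reasoning

module _ (π : ℕ ↔ ℕ) where
  open Inverse π

  transport : Op → Op
  transport H a b = to (H (from a) (from b))

  from-IsHom : ∀ H → IsHom (transport H) H from
  from-IsHom H a b = strictlyInverseʳ _

  from-bijective : Bijective _≡_ _≡_ from
  from-bijective = Bijection.bijective (Inverse⇒Bijection (↔-sym π))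

  transport-isomorphic : ∀ H → Isomorphic (transport H) H
  transport-isomorphic H = from , from-IsHom H , from-bijective

  transport-𝒯 : ∀ {H} → to 0 ≡ 0 → 𝒯 H → 𝒯 (transport H)
  transport-𝒯 {H} to0≡0 = 𝒯-pullback (from-IsHom H) from0≡0 from-bijective
    where
    from0≡0 : from 0 ≡ 0
    from0≡0 = trans (cong from (sym to0≡0)) (strictlyInverseʳ 0)

supportList : ℕ → Op → List ℕ
supportList k m = upTo (suc k) ++ cartesianProductWith m (upTo (suc k)) (upTo (suc k))

∈-supportList-index : ∀ {k m i} → i ≤ k → i ∈ supportList k m
∈-supportList-index i≤k = ∈-++⁺ˡ (∈-upTo⁺ (s≤s i≤k))

∈-supportList-entry : ∀ {k m i j} → i ≤ k → j ≤ k → m i j ∈ supportList k m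
∈-supportList-entry {k} i≤k j≤k =
  ∈-++⁺ʳ (upTo (suc k)) (∈-cartesianProductWith⁺ _ (∈-upTo⁺ (s≤s i≤k)) (∈-upTo⁺ (s≤s j≤k)))

-- The index 0 is not in InSupp's range {1,…,k}; it is covered as the entry m 0 0.
supportList⇒InSupp : ∀ {k m x} → m 0 0 ≡ 0 → x ∈ supportList k m → InSupp k m x
supportList⇒InSupp {k} {m} m00≡0 x∈ with ∈-++⁻ (upTo (suc k)) x∈
... | inj₁ x∈upTo with ∈-upTo⁻ x∈upTo
...   | s≤s {ℕ.zero}  _   = inj₂ (0 , 0 , z≤n , z≤n , m00≡0)
...   | s≤s {suc _}   x≤k = inj₁ (s≤s z≤n , x≤k)
supportList⇒InSupp {k} {m} _ x∈ | inj₂ x∈entries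
  with i , j , i∈ , j∈ , refl ← ∈-cartesianProductWith⁻ m (upTo (suc k)) (upTo (suc k)) x∈entries
  with s≤s i≤k ← ∈-upTo⁻ i∈ | s≤s j≤k ← ∈-upTo⁻ j∈
  = inj₂ (i , j , i≤k , j≤k , refl)

isomorphic-copy-agreeing : ∀ {k m G H φ} → m 0 0 ≡ 0 → 𝒯 G → 𝒯 H → AgreeUpTo k G m →
  IsHom G H φ → InjectiveOn (InSupp k m) φ →
  ∃[ H′ ] (𝒯 H′ × Isomorphic H′ H × AgreeUpTo k m H′)
isomorphic-copy-agreeing {k} {m} {G} {H} {φ} m00≡0 𝒯G 𝒯H G≈m hom injective
  with π , π∘φ≡id ← Permutations.left-inverse-extends-to-permutation ℕ._≟_ φ (supportList k m)
                      (λ {y} {z} p q → injective y z (supportList⇒InSupp m00≡0 p)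
                                                      (supportList⇒InSupp m00≡0 q))
  = transport π H , transport-𝒯 π to0≡0 𝒯H , transport-isomorphic π H , m≈H′
  where
  open Inverse

  to0≡0 : to π 0 ≡ 0
  to0≡0 = trans (cong (to π) (sym (IsHom-0 𝒯G 𝒯H hom))) (π∘φ≡id (∈-supportList-index z≤n))

  from≡φ : ∀ {i} → i ≤ k → from π i ≡ φ i
  from≡φ i≤k = trans (cong (from π) (sym (π∘φ≡id (∈-supportList-index i≤k))))
                     (strictlyInverseʳ π (φ _))

  m≈H′ : AgreeUpTo k m (transport π H)
  m≈H′ i j i≤k j≤k = begin
    m i j                                ≡⟨ π∘φ≡id (∈-supportList-entry i≤k j≤k) ⟨
    to π (φ (m i j))                     ≡⟨ cong (to π ∘ φ) (G≈m i j i≤k j≤k) ⟨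
    to π (φ (G i j))                     ≡⟨ cong (to π) (hom i j) ⟩
    to π (H (φ i) (φ j))                 ≡⟨ cong₂ (λ u v → to π (H u v)) (from≡φ i≤k) (from≡φ j≤k) ⟨
    to π (H (from π i) (from π j))       ∎
    where open ≡-Reasoning

lemma2p14 : (P S : OpSet) → IsGroupProperty P → IsGroupProperty S → P ⊆ S →
    (∀ (k : ℕ) (m : Op) → (∃[ G ] InBasic S k m G) →
      ∃[ G₀ ] ∃[ H ] ∃[ φ ]
        (InBasic S k m G₀ × P H × IsHom G₀ H φ × InjectiveOn (InSupp k m) φ)) →
    Dense P S
lemma2p14 P S (P⊆𝒯 , P-invariant) (S⊆𝒯 , _) _ hyp U U-open (G , G∈S , G∈U)
  with k , nbhd⊆U ← U-open G G∈U
  with G₀ , H , φ , (G₀∈S , G₀≈G) , H∈P , hom , injective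
         ← hyp k G (G , G∈S , λ _ _ _ _ → refl)
  with H′ , 𝒯H′ , H′≅H , G≈H′ ←
         isomorphic-copy-agreeing (IsTFAbOp.identityˡ (S⊆𝒯 G G∈S) 0) (S⊆𝒯 G₀ G₀∈S) (P⊆𝒯 H H∈P)
                                  G₀≈G hom injective
  = H′ , P-invariant H′ H 𝒯H′ H∈P H′≅H , nbhd⊆U H′ G≈H′
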